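{- Let $M=\langle W,\mathcal{N},\leq,V\rangle$ be the canonical model for $\mathbf{WW}$, with $\mathcal{N}_w=\{\widehat{\varphi}:\mathsf{W}\varphi\in w\}$. Then $M$ is a $\mathsf{WW}$-PN-model; in particular, for every $w\in W$ and $X,Y\in\mathcal{N}_w$ we have $X\cap Y\in\mathcal{N}_w$.
   Context: Formulas are built from a countable set $PV$ of propositional variables and $\bot$ by $\land,\lor,\rightarrow$ and a unary modal operator $\mathsf{W}$; $\lnot\varphi$ abbreviates $\varphi\to\bot$, $\varphi\leftrightarrow\psi$ abbreviates $(\varphi\to\psi)\land(\psi\to\varphi)$. The logic $\mathbf{WW}$ is the smallest set of formulas containing all instances of the axiom schemes of intuitionistic propositional logic, all instances of $\mathsf{W}\varphi\to\lnot\varphi$ and of $(\mathsf{W}\varphi\land\mathsf{W}\psi)\to\mathsf{W}(\varphi\land\psi)$, closed under modus ponens and the rule: from $\varphi\leftrightarrow\psi$ infer $\mathsf{W}\varphi\leftrightarrow\mathsf{W}\psi$. A prime theory of $\mathbf{WW}$ is a set $w$ of formulas with $\mathbf{WW}\subseteq w$, closed under modus ponens, $\bot\notin w$, and $\varphi\lor\psi\in w$ implies $\varphi\in w$ or $\psi\in w$. The canonical model: $W$ = all prime theories of $\mathbf{WW}$, $w\leq v$ iff $w\subseteq v$, $V(q)=\{w:q\in w\}$, $\widehat{\varphi}=\{z\in W:\varphi\in z\}$. A $\mathsf{WW}$-PN-model is a quadruple $\langle W,\mathcal{N},\leq,V\rangle$ with $\leq$ a partial order, $\mathcal{N}:W\to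 P(P(W))$, $V:PV\to P(W)$ with each $V(q)$ upward closed, such that (i) for all $w,v$ and $X$: if $w\leq v$, $X\in\mathcal{N}_w$ and $v\notin X$ then $X\in\mathcal{N}_v$; and (ii) each $\mathcal{N}_w$ is closed under binary intersections. -}

module Defs where

open import Level using (Level; _⊔_) renaming (suc to lsuc; zero to lzero)
open import Data.Nat using (ℕ)
open import Data.Product using (Σ; ∃; ∃-syntax; _×_; _,_; proj₁)
open import Data.Sum using (_⊎_)
open import Relation.Nullary using (¬_)
open import Relation.Binary.Structures using (IsPartialOrder)

PV : Set
PV = ℕ

infixr 4 _⇒_
infixr 5 _∨_
infixr 6 _∧_

data Formula : Set where
  var : PV → Formula
  ⊥'  : Formula
  _∧_ : Formula → Formula → Formula
  _∨_ : Formula → Formula → Formula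
  _⇒_ : Formula → Formula → Formula
  𝖶   : Formula → Formula

¬'_ : Formula → Formula
¬' φ = φ ⇒ ⊥'

_⇔_ : Formula → Formula → Formula
φ ⇔ ψ = (φ ⇒ ψ) ∧ (ψ ⇒ φ)

data IPCAxiom : Formula → Set where
  ax-K    : ∀ φ ψ → IPCAxiom (φ ⇒ ψ ⇒ φ)
  ax-S    : ∀ φ ψ χ → IPCAxiom ((φ ⇒ ψ ⇒ χ) ⇒ (φ ⇒ ψ) ⇒ φ ⇒ χ)
  ax-∧I   : ∀ φ ψ → IPCAxiom (φ ⇒ ψ ⇒ φ ∧ ψ)
  ax-∧E₁  : ∀ φ ψ → IPCAxiom (φ ∧ ψ ⇒ φ)
  ax-∧E₂  : ∀ φ ψ → IPCAxiom (φ ∧ ψ ⇒ ψ)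
  ax-∨I₁  : ∀ φ ψ → IPCAxiom (φ ⇒ φ ∨ ψ)
  ax-∨I₂  : ∀ φ ψ → IPCAxiom (ψ ⇒ φ ∨ ψ)
  ax-∨E   : ∀ φ ψ χ → IPCAxiom ((φ ⇒ χ) ⇒ (ψ ⇒ χ) ⇒ φ ∨ ψ ⇒ χ)
  ax-efq  : ∀ φ → IPCAxiom (⊥' ⇒ φ)

data WW : Formula → Set where
  ipc     : ∀ {φ} → IPCAxiom φ → WW φ
  w-neg   : ∀ φ → WW (𝖶 φ ⇒ ¬' φ)
  w-conj  : ∀ φ ψ → WW ((𝖶 φ ∧ 𝖶 ψ) ⇒ 𝖶 (φ ∧ ψ))
  mp      : ∀ {φ ψ} → WW (φ ⇒ ψ) → WW φ → WW ψ
  re      : ∀ {φ ψ} → WW (φ ⇔ ψ) → WW (𝖶 φ ⇔ 𝖶 ψ)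

record IsPrimeTheory (w : Formula → Set) : Set where
  field
    contains-WW : ∀ {φ} → WW φ → w φ
    closed-mp   : ∀ {φ ψ} → w (φ ⇒ ψ) → w φ → w ψ
    consistent  : ¬ w ⊥'
    prime       : ∀ {φ ψ} → w (φ ∨ ψ) → w φ ⊎ w ψ

CW : Set₁
CW = Σ (Formula → Set) IsPrimeTheory

_≈C_ : CW → CW → Set
w ≈C v = ∀ φ → (proj₁ w φ → proj₁ v φ) × (proj₁ v φ → proj₁ w φ)

_≤C_ : CW → CW → Set
w ≤C v = ∀ {φ} → proj₁ w φ → proj₁ v φ

CV : PV → CW → Set
CV q w = proj₁ w (var q)

hat : Formula → CW → Set
hat φ z = proj₁ z φ

_≐_ : ∀ {a ℓ₁ ℓ₂} {A : Set a} → (A → Set ℓ₁) → (A → Set ℓ₂) → Set (a ⊔ ℓ₁ ⊔ ℓ₂)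
X ≐ Y = ∀ u → (X u → Y u) × (Y u → X u)

CN : CW → (CW → Set) → Set₁
CN w X = ∃[ φ ] (proj₁ w (𝖶 φ) × X ≐ hat φ)

_∩_ : ∀ {a ℓ} {A : Set a} → (A → Set ℓ) → (A → Set ℓ) → A → Set ℓ
(X ∩ Y) u = X u × Y u

record IsWWPNModel {a e r ℓ n : Level} (W : Set a) (_≈_ : W → W → Set e)
       (N : W → (W → Set ℓ) → Set n) (_≤_ : W → W → Set r)
       (V : PV → W → Set ℓ) : Set (a ⊔ e ⊔ r ⊔ lsuc ℓ ⊔ n) where
  field
    partialOrder : IsPartialOrder _≈_ _≤_
    V-upward     : ∀ q {w v} → w ≤ v → V q w → V q v
    N-persist    : ∀ {w v} (X : W → Set ℓ) → w ≤ v → N w X → ¬ X v → N v X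
    N-∩          : ∀ w (X Y : W → Set ℓ) → N w X → N w Y → N w (X ∩ Y)

module Submission where

-- Everything reduces to membership in prime theories: ⊆ is a partial order, 𝖶φ ∈ w
-- is inherited by every extension of w, and since prime theories are closed under
-- ∧-introduction and elimination, φ̂ ∩ ψ̂ = (φ ∧ ψ)^, while the axiom
-- 𝖶φ ∧ 𝖶ψ → 𝖶(φ ∧ ψ) puts 𝖶(φ ∧ ψ) into w.

open import Defs
open import Data.Product using (_,_; proj₁; proj₂; map)
open import Function using (id; _∘_)
open import Relation.Binary.Structures using (IsEquivalence; IsPartialOrder)

module PrimeTheory {w : Formula → Set} (t : IsPrimeTheory w) where
  open IsPrimeTheory t

  ∧-intro : ∀ {φ ψ} → w φ → w ψ → w (φ ∧ ψ)
  ∧-intro p q = closed-mp (closed-mp (contains-WW (ipc (ax-∧I _ _))) p) q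

  ∧-elim₁ : ∀ {φ ψ} → w (φ ∧ ψ) → w φ
  ∧-elim₁ = closed-mp (contains-WW (ipc (ax-∧E₁ _ _)))

  ∧-elim₂ : ∀ {φ ψ} → w (φ ∧ ψ) → w ψ
  ∧-elim₂ = closed-mp (contains-WW (ipc (ax-∧E₂ _ _)))

  𝖶-∧ : ∀ {φ ψ} → w (𝖶 φ) → w (𝖶 ψ) → w (𝖶 (φ ∧ ψ))
  𝖶-∧ p q = closed-mp (contains-WW (w-conj _ _)) (∧-intro p q)

hat-∩ : ∀ φ ψ → (hat φ ∩ hat ψ) ≐ hat (φ ∧ ψ)
hat-∩ φ ψ (u , t) = (λ (p , q) → ∧-intro p q) , λ c → ∧-elim₁ c , ∧-elim₂ c
  where open PrimeTheory t

∩-resp-≐ : ∀ {a ℓ} {A : Set a} {X X′ Y Y′ : A → Set ℓ} →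
           X ≐ X′ → Y ≐ Y′ → (X ∩ Y) ≐ (X′ ∩ Y′)
∩-resp-≐ eX eY u = map (proj₁ (eX u)) (proj₁ (eY u)) , map (proj₂ (eX u)) (proj₂ (eY u))

≐-trans : ∀ {a ℓ₁ ℓ₂ ℓ₃} {A : Set a} {X : A → Set ℓ₁} {Y : A → Set ℓ₂} {Z : A → Set ℓ₃} →
          X ≐ Y → Y ≐ Z → X ≐ Z
≐-trans eXY eYZ u = proj₁ (eYZ u) ∘ proj₁ (eXY u) , proj₂ (eXY u) ∘ proj₂ (eYZ u)

≈C-isEquivalence : IsEquivalence _≈C_
≈C-isEquivalence = record
  { refl  = λ _ → id , id
  ; sym   = λ e φ → proj₂ (e φ) , proj₁ (e φ)
  ; trans = λ e f φ → proj₁ (f φ) ∘ proj₁ (e φ) , proj₂ (e φ) ∘ proj₂ (f φ)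
  }

≤C-isPartialOrder : IsPartialOrder _≈C_ _≤C_
≤C-isPartialOrder = record
  { isPreorder = record
    { isEquivalence = ≈C-isEquivalence
    ; reflexive     = λ e {φ} → proj₁ (e φ)
    ; trans         = λ p q → q ∘ p
    }
  ; antisym = λ p q φ → p , q
  }

CN-persist : ∀ {w v} X → w ≤C v → CN w X → CN v X
CN-persist X w≤v (φ , w𝖶φ , X≐φ̂) = φ , w≤v w𝖶φ , X≐φ̂

CN-∩ : ∀ w X Y → CN w X → CN w Y → CN w (X ∩ Y)
CN-∩ (w , t) X Y (φ , w𝖶φ , X≐φ̂) (ψ , w𝖶ψ , Y≐ψ̂) =
  φ ∧ ψ , PrimeTheory.𝖶-∧ t w𝖶φ w𝖶ψ
        , ≐-trans (∩-resp-≐ X≐φ̂ Y≐ψ̂) (hat-∩ φ ψ)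

mainTheorem5 : IsWWPNModel CW _≈C_ CN _≤C_ CV
mainTheorem5 = record
  { partialOrder = ≤C-isPartialOrder
  ; V-upward     = λ q w≤v → w≤v
  -- 𝖶φ ∈ w persists along ⊆ unconditionally.
  ; N-persist    = λ {w} {v} X w≤v wX _ → CN-persist {w} {v} X w≤v wX
  ; N-∩          = CN-∩
  }
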